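{- Let $H$ be a 3-uniform marked hyperforest that is not a trivial Maker win, with $|V(H)\setminus M(H)|\ge2$. Then $H$ is a Breaker win if and only if $J_1(\mathcal S,H)$ holds.
   Context: A marked hypergraph $H$: finite nonempty $V(H)$, edge set $E(H)$ of nonempty subsets of $V(H)$, marked set $M(H)\subseteq V(H)$; 3-uniform: all edges of size 3. Subhypergraph $X$: $V(X)\subseteq V(H)$, $E(X)\subseteq E(H)$, $M(X)=V(X)\cap M(H)$. $H^{+x}$ marks non-marked $x$; $H^{ -y}$ deletes $y$ and all edges containing it. Trivial Maker win: some edge $e$ with $|e\setminus M(H)|\le1$. Maker win (recursive): if $|V(H)\setminus M(H)|\le1$, iff trivial Maker win; otherwise iff some non-marked $x$ has $H^{+x-y}$ a Maker win for all non-marked $y\ne x$; otherwise Breaker win. $ab$-path of length $L\ge1$: edges $e_1,\dots,e_L$ (3-sets), vertex set $\bigcup e_i$, $|e_i\cap e_{i+1}|=1$, $e_i\cap e_j=\varnothing$ for $|i-j|\ge2$, $a\ne b$, $a\in e_1\setminus\bigcup_{i\ge2}e_i$, $b\in e_L\setminus\bigcup_{i<L}e_i$. $a$-cycle of length $L\ge2$: edges $e_1,\dots,e_L$, vertex set $\bigcup e_i$, $a\in e_1\cap e_L$, $a\notin e_i$ for $1<i<L$; if $L=2$, $|e_1\cap e_2|=2$; if $L\ge3$, $|e_i\cap e_{i+1}|=1$, $e_1\cap e_L=\{a\}$, other pairs with $|i-j|\ge2$ disjoint. A 3-uniform marked hyperforest contains no cycle. An $x$-snake is an $xm$-path of positive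 length with $m$ marked. $\mathcal S$: all pointed marked hypergraphs $(S,x)$ ($x$ non-marked) with $S$ an $x$-snake having exactly one marked vertex. $x\mathcal S(H)$: subhypergraphs $X\ni x$ of $H$ with $(X,x)$ isomorphic (bijection preserving edges, marks, point) to a member of $\mathcal S$. $\mathrm{Int}_H(\mathcal X)$: non-marked vertices of $H$ lying in every member of $\mathcal X$. $J_1(\mathcal S,H)$: for every $x\in V(H)\setminus M(H)$, $\mathrm{Int}_{H^{+x}}(x\mathcal S(H))\ne\varnothing$. -}

module Defs where

open import Data.Nat using (ℕ; zero; suc; _≤_; _<_; _+_)
open import Data.Fin using (Fin; toℕ; fromℕ) renaming (zero to fz)
open import Data.Fin.Subset using (Subset; _∈_; _∉_; _⊆_; _∩_; _∪_; _─_; _-_; ⁅_⁆; ∣_∣; ⋃; Empty; Nonempty)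
open import Data.Fin.Subset.Properties using (_∈?_)
open import Data.List using (List; filter; tabulate)
open import Data.List.Membership.Propositional using () renaming (_∈_ to _∈ₗ_)
open import Data.List.Relation.Unary.All using (All)
open import Data.Product using (Σ; ∃; ∃-syntax; _×_)
open import Relation.Nullary using (¬_; ¬?)
open import Relation.Binary.PropositionalEquality using (_≡_; _≢_)

-- V = vertex set, E = edge set (a list, read as the set of its members),
-- M = marked set.
record MHG (n : ℕ) : Set where
  constructor mhg
  field
    V : Subset n
    E : List (Subset n)
    M : Subset n
open MHG public

module _ {n : ℕ} where

  WF : MHG n → Set
  WF H = Nonempty (V H) × All (λ e → Nonempty e × e ⊆ V H) (E H) × M H ⊆ V H

  NonMarked : MHG n → Subset n
  NonMarked H = V H ─ M H

  mark : Fin n → MHG n → MHG n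
  mark x H = mhg (V H) (E H) (M H ∪ ⁅ x ⁆)

  del : Fin n → MHG n → MHG n
  del y H = mhg (V H - y) (filter (λ e → ¬? (y ∈? e)) (E H)) (M H - y)

  ThreeUniform : MHG n → Set
  ThreeUniform H = ∀ e → e ∈ₗ E H → ∣ e ∣ ≡ 3

  TrivialMakerWin : MHG n → Set
  TrivialMakerWin H = ∃[ e ] (e ∈ₗ E H × ∣ e ─ M H ∣ ≤ 1)

  -- Maker win, the recursive definition as an inductive predicate
  -- (recursion is well founded: |V \ M| strictly decreases)
  data MakerWin (H : MHG n) : Set where
    base : ∣ NonMarked H ∣ ≤ 1 → TrivialMakerWin H → MakerWin H
    step : 2 ≤ ∣ NonMarked H ∣ → (x : Fin n) → x ∈ NonMarked H →
           (∀ y → y ∈ NonMarked (mark x H) → MakerWin (del y (mark x H))) →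
           MakerWin H

  BreakerWin : MHG n → Set
  BreakerWin H = ¬ MakerWin H

  IsSub : MHG n → MHG n → Set
  IsSub X H = WF X × V X ⊆ V H × (∀ e → e ∈ₗ E X → e ∈ₗ E H) × M X ≡ V X ∩ M H

  SpannedBy : {L : ℕ} → MHG n → (Fin L → Subset n) → Set
  SpannedBy {L} X es =
    (∀ i → es i ∈ₗ E X) × (∀ e → e ∈ₗ E X → ∃[ i ] es i ≡ e) × V X ≡ ⋃ (tabulate es)

  -- ab-path conditions on an edge sequence e_0..e_k (length L = k+1 ≥ 1)
  PathSeq : (k : ℕ) → (Fin (suc k) → Subset n) → Fin n → Fin n → Set
  PathSeq k es a b =
    (∀ i → ∣ es i ∣ ≡ 3) ×
    (∀ i j → toℕ j ≡ suc (toℕ i) → ∣ es i ∩ es j ∣ ≡ 1) ×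
    (∀ i j → 2 + toℕ i ≤ toℕ j → Empty (es i ∩ es j)) ×
    a ≢ b ×
    a ∈ es fz × (∀ i → 1 ≤ toℕ i → a ∉ es i) ×
    b ∈ es (fromℕ k) × (∀ i → toℕ i < k → b ∉ es i)

  IsPath : MHG n → Fin n → Fin n → Set
  IsPath X a b = ∃[ k ] Σ (Fin (suc k) → Subset n) λ es → PathSeq k es a b × SpannedBy X es

  -- a-cycle conditions on an edge sequence e_0..e_{k+1} (length L = k+2 ≥ 2)
  CycleSeq : (k : ℕ) → (Fin (suc (suc k)) → Subset n) → Fin n → Set
  CycleSeq k es a =
    (∀ i → ∣ es i ∣ ≡ 3) ×
    a ∈ es fz × a ∈ es (fromℕ (suc k)) ×
    (∀ i → 1 ≤ toℕ i → toℕ i < suc k → a ∉ es i) ×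
    (k ≡ 0 → ∣ es fz ∩ es (fromℕ (suc k)) ∣ ≡ 2) ×
    (1 ≤ k →
      (∀ i j → toℕ j ≡ suc (toℕ i) → ∣ es i ∩ es j ∣ ≡ 1) ×
      es fz ∩ es (fromℕ (suc k)) ≡ ⁅ a ⁆ ×
      (∀ i j → 2 + toℕ i ≤ toℕ j → ¬ (toℕ i ≡ 0 × toℕ j ≡ suc k) → Empty (es i ∩ es j)))

  IsCycle : MHG n → Fin n → Set
  IsCycle X a = ∃[ k ] Σ (Fin (suc (suc k)) → Subset n) λ es → CycleSeq k es a × SpannedBy X es

  NoCycle : MHG n → Set
  NoCycle H = ¬ (∃[ X ] ∃[ a ] (IsSub X H × IsCycle X a))

  ThreeUniformHyperforest : MHG n → Set
  ThreeUniformHyperforest H = ThreeUniform H × NoCycle H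

  IsSnake : MHG n → Fin n → Set
  IsSnake X x = ∃[ m ] (m ∈ M X × IsPath X x m)

  InS : MHG n → Fin n → Set
  InS X x = x ∈ V X × x ∉ M X × IsSnake X x × ∣ M X ∣ ≡ 1

  InxS : MHG n → Fin n → MHG n → Set
  InxS H x X = IsSub X H × InS X x

  -- J_1(S, H): for every non-marked x, Int_{H^{+x}}(xS(H)) ≠ ∅
  J1 : MHG n → Set
  J1 H = ∀ x → x ∈ NonMarked H →
         ∃[ v ] (v ∈ NonMarked (mark x H) × (∀ X → InxS H x X → v ∈ V X))

-- A path of edges joining two marked vertices is a Maker win: Maker marks the vertex where its
-- first two edges meet, and Breaker can then spoil only one of the two parts, the first edge or the
-- rest of the path.  Hence, if Breaker wins, his winning answer y to a first move x lies in every
-- x-snake, since otherwise that snake becomes such a path in H^{+x−y}; this is J₁.  Conversely,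
-- Breaker answers every move x by a vertex v in all x-snakes.  The new position is again a
-- hyperforest without trivial Maker win (an edge {x, u, m} with only m marked is an x-snake), and it
-- satisfies J₁ again: if no x′-snake passes through x, the x′-snakes are those of H; if one, P,
-- does, the vertex u ≠ x′, x of its first edge lies in every x′-snake S, for otherwise P and S
-- would combine into an x-snake of H missing v or into a cycle.  Induction on the number of free
-- vertices concludes.  Snakes and cycles are cut out of walks by shortcutting, which works because
-- edges of a hyperforest share at most one vertex.

module Submission where

open import Defs
open import Data.Empty using (⊥; ⊥-elim)
open import Data.Fin using (Fin; toℕ; fromℕ; _≟_) renaming (zero to fz; suc to fs)
import Data.Fin.Properties as Finₚ
open import Data.Fin.Subset hiding (⊥)
open import Data.Fin.Subset.Properties
import Data.List as List
open import Data.List using (tabulate)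
open import Data.List.Membership.Propositional using (find; lose) renaming (_∈_ to _∈ₗ_)
open import Data.List.Membership.Propositional.Properties using (∈-tabulate⁺; ∈-tabulate⁻; ∈-filter⁺; ∈-filter⁻)
import Data.List.Relation.Unary.All as All
import Data.List.Relation.Unary.All.Properties as Allₚ
import Data.List.Relation.Unary.Any as Any
open import Data.Nat using (ℕ; zero; suc; _≤_; _<_; _+_; _∸_; z≤n; s≤s; _≤?_) renaming (_≟_ to _≟ℕ_)
open import Data.Nat.Induction using (<-wellFounded)
open import Data.Nat.Properties
  using (≤-refl; ≤-trans; ≤-reflexive; ≤-antisym; ≤-pred; <⇒≤; ≰⇒>; ≤⇒≯; ≤∧≢⇒<; <-≤-trans; <-irrefl;
         n≤1+n; m≤n+m; +-identityʳ; +-suc; +-monoˡ-≤; m∸n≤m; n∸n≡0; suc-injective)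
open import Data.Product using (∃-syntax; _×_; _,_; proj₁; proj₂)
open import Data.Sum using (_⊎_; inj₁; inj₂; [_,_]′)
open import Data.Vec using (_∷_; here; there)
open import Data.Vec.Functional using () renaming (_∷_ to _∷ᶠ_)
open import Function using (_∘′_)
open import Function.Bundles using (_⇔_; mk⇔)
open import Induction.WellFounded using (WellFounded)
import Induction.WellFounded as WF
open import Level using (0ℓ)
import Relation.Binary.Construct.On as On
open import Relation.Binary.PropositionalEquality using (_≡_; _≢_; refl; sym; trans; cong; subst; module ≡-Reasoning)
open import Relation.Nullary using (¬_; ¬?; Dec; yes; no; contradiction)
open import Relation.Nullary.Decidable using (map′; decidable-stable; ¬¬-excluded-middle; _→-dec_)

private variable n : ℕ

-- Finite sets

x∈p─q⁻ : ∀ {p q : Subset n} {x} → x ∈ p ─ q → x ∈ p × x ∉ q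
x∈p─q⁻ {p = inside ∷ p} {outside ∷ q} {fz} here = here , λ ()
x∈p─q⁻ {p = inside ∷ p} {inside ∷ q} {fz} ()
x∈p─q⁻ {p = outside ∷ p} {inside ∷ q} {fz} ()
x∈p─q⁻ {p = outside ∷ p} {outside ∷ q} {fz} ()
x∈p─q⁻ {p = s ∷ p} {t ∷ q} {fs x} (there x∈) with x∈p─q⁻ {p = p} {q} x∈
... | x∈p , x∉q = there x∈p , λ { (there x∈q) → x∉q x∈q }

x∈p-y⁻ : ∀ {p : Subset n} {x y} → x ∈ p - y → x ∈ p × x ≢ y
x∈p-y⁻ x∈ with x∈p─q⁻ x∈
... | x∈p , x∉y = x∈p , x∉⁅y⁆⇒x≢y x∉y

∣p∣≡1+∣p-x∣ : ∀ (p : Subset n) {x} → x ∈ p → ∣ p ∣ ≡ suc ∣ p - x ∣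
∣p∣≡1+∣p-x∣ (inside ∷ p) {fz} here = cong suc (sym (cong ∣_∣ (p─⊥≡p p)))
∣p∣≡1+∣p-x∣ (outside ∷ p) {fs x} (there x∈p) = ∣p∣≡1+∣p-x∣ p x∈p
∣p∣≡1+∣p-x∣ (inside ∷ p) {fs x} (there x∈p) = cong suc (∣p∣≡1+∣p-x∣ p x∈p)

0<∣p∣⇒Nonempty : ∀ (p : Subset n) → 0 < ∣ p ∣ → Nonempty p
0<∣p∣⇒Nonempty (inside ∷ p) _ = fz , here
0<∣p∣⇒Nonempty (outside ∷ p) 0<∣p∣ with 0<∣p∣⇒Nonempty p 0<∣p∣
... | x , x∈p = fs x , there x∈p

x∈p⇒0<∣p∣ : ∀ (p : Subset n) {x} → x ∈ p → 0 < ∣ p ∣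
x∈p⇒0<∣p∣ p {x} x∈p rewrite ∣p∣≡1+∣p-x∣ p x∈p = s≤s z≤n

2≤∣p∣ : ∀ (p : Subset n) {x y} → x ∈ p → y ∈ p → y ≢ x → 2 ≤ ∣ p ∣
2≤∣p∣ p x∈p y∈p y≢x rewrite ∣p∣≡1+∣p-x∣ p x∈p = s≤s (x∈p⇒0<∣p∣ (p - _) (x∈p∧x≢y⇒x∈p-y y∈p y≢x))

3≤∣p∣ : ∀ (p : Subset n) {x y z} → x ∈ p → y ∈ p → z ∈ p → y ≢ x → z ≢ x → z ≢ y → 3 ≤ ∣ p ∣
3≤∣p∣ p x∈p y∈p z∈p y≢x z≢x z≢y rewrite ∣p∣≡1+∣p-x∣ p x∈p =
  s≤s (2≤∣p∣ (p - _) (x∈p∧x≢y⇒x∈p-y y∈p y≢x) (x∈p∧x≢y⇒x∈p-y z∈p z≢x) z≢y)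

∣p∣≤1⇒x≡y : ∀ (p : Subset n) {x y} → ∣ p ∣ ≤ 1 → x ∈ p → y ∈ p → y ≡ x
∣p∣≤1⇒x≡y p {x} {y} ∣p∣≤1 x∈p y∈p with y ≟ x
... | yes y≡x = y≡x
... | no y≢x with ≤-trans (2≤∣p∣ p x∈p y∈p y≢x) ∣p∣≤1
...   | s≤s ()

∣p∣≡1⇒x≡y : ∀ (p : Subset n) {x y} → ∣ p ∣ ≡ 1 → x ∈ p → y ∈ p → y ≡ x
∣p∣≡1⇒x≡y p ∣p∣≡1 = ∣p∣≤1⇒x≡y p (≤-reflexive ∣p∣≡1)

∃-other : ∀ (p : Subset n) {x} → 2 ≤ ∣ p ∣ → x ∈ p → ∃[ y ] (y ∈ p × y ≢ x)
∃-other p {x} 2≤∣p∣ x∈p rewrite ∣p∣≡1+∣p-x∣ p x∈p with 0<∣p∣⇒Nonempty (p - x) (≤-pred 2≤∣p∣)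
... | y , y∈p-x = y , x∈p-y⁻ y∈p-x

∃-third : ∀ (p : Subset n) {x} y → 2 < ∣ p ∣ → x ∈ p → ∃[ z ] (z ∈ p × z ≢ x × z ≢ y)
∃-third p {x} y 2<∣p∣ x∈p with y ∈? p | y ≟ x
... | no y∉p | _ = let z , z∈p , z≢x = ∃-other p (<⇒≤ 2<∣p∣) x∈p in z , z∈p , z≢x , λ { refl → y∉p z∈p }
... | yes _ | yes refl = let z , z∈p , z≢x = ∃-other p (<⇒≤ 2<∣p∣) x∈p in z , z∈p , z≢x , z≢x
... | yes y∈p | no y≢x rewrite ∣p∣≡1+∣p-x∣ p x∈p with ∃-other (p - x) (≤-pred 2<∣p∣) (x∈p∧x≢y⇒x∈p-y y∈p y≢x)
...   | z , z∈p-x , z≢y = z , proj₁ (x∈p-y⁻ z∈p-x) , proj₂ (x∈p-y⁻ z∈p-x) , z≢y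

∣p∣≡3⇒members : ∀ (p : Subset n) {x y z w} → ∣ p ∣ ≡ 3 → x ∈ p → y ∈ p → z ∈ p →
                y ≢ x → z ≢ x → z ≢ y → w ∈ p → w ≡ x ⊎ w ≡ y ⊎ w ≡ z
∣p∣≡3⇒members p {x} {y} {z} {w} ∣p∣≡3 x∈p y∈p z∈p y≢x z≢x z≢y w∈p with w ≟ x | w ≟ y | w ≟ z
... | yes w≡x | _ | _ = inj₁ w≡x
... | no _ | yes w≡y | _ = inj₂ (inj₁ w≡y)
... | no _ | no _ | yes w≡z = inj₂ (inj₂ w≡z)
... | no w≢x | no w≢y | no w≢z with subst (4 ≤_) ∣p∣≡3 4≤∣p∣
  where
  4≤∣p∣ : 4 ≤ ∣ p ∣
  4≤∣p∣ rewrite ∣p∣≡1+∣p-x∣ p w∈p =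
    s≤s (3≤∣p∣ (p - w) (x∈p∧x≢y⇒x∈p-y x∈p (w≢x ∘′ sym)) (x∈p∧x≢y⇒x∈p-y y∈p (w≢y ∘′ sym))
               (x∈p∧x≢y⇒x∈p-y z∈p (w≢z ∘′ sym)) y≢x z≢x z≢y)
...   | s≤s (s≤s (s≤s ()))

p⊆q∧∣q∣≤∣p∣⇒q⊆p : ∀ {p q : Subset n} → p ⊆ q → ∣ q ∣ ≤ ∣ p ∣ → q ⊆ p
p⊆q∧∣q∣≤∣p∣⇒q⊆p {p = p} p⊆q ∣q∣≤∣p∣ {y} y∈q with y ∈? p
... | yes y∈p = y∈p
... | no y∉p = ⊥-elim (<-irrefl refl (≤-trans (p⊂q⇒∣p∣<∣q∣ (p⊆q , y , y∈q , y∉p)) ∣q∣≤∣p∣))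

∣p∩q∣≤2 : ∀ (p q : Subset n) → ∣ p ∣ ≡ 3 → ∣ q ∣ ≡ 3 → p ≢ q → ∣ p ∩ q ∣ ≤ 2
∣p∩q∣≤2 p q ∣p∣≡3 ∣q∣≡3 p≢q with ∣ p ∩ q ∣ ≤? 2
... | yes ∣p∩q∣≤2 = ∣p∩q∣≤2
... | no ∣p∩q∣≰2 = ⊥-elim (p≢q (⊆-antisym (λ x∈p → proj₂ (x∈p∩q⁻ p q (p⊆p∩q x∈p)))
                                          (λ x∈q → proj₁ (x∈p∩q⁻ p q (q⊆p∩q x∈q)))))
  where
  p⊆p∩q : p ⊆ p ∩ q
  p⊆p∩q = p⊆q∧∣q∣≤∣p∣⇒q⊆p (p∩q⊆p p q) (subst (_≤ ∣ p ∩ q ∣) (sym ∣p∣≡3) (≰⇒> ∣p∩q∣≰2))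
  q⊆p∩q : q ⊆ p ∩ q
  q⊆p∩q = p⊆q∧∣q∣≤∣p∣⇒q⊆p (p∩q⊆q p q) (subst (_≤ ∣ p ∩ q ∣) (sym ∣q∣≡3) (≰⇒> ∣p∩q∣≰2))

x∈⋃⁺ : ∀ {x : Fin n} {p ps} → x ∈ p → p ∈ₗ ps → x ∈ ⋃ ps
x∈⋃⁺ x∈p (Any.here refl) = x∈p∪q⁺ (inj₁ x∈p)
x∈⋃⁺ x∈p (Any.there p∈ps) = x∈p∪q⁺ (inj₂ (x∈⋃⁺ x∈p p∈ps))

x∈⋃⁻ : ∀ {x : Fin n} ps → x ∈ ⋃ ps → ∃[ p ] (p ∈ₗ ps × x ∈ p)
x∈⋃⁻ List.[] x∈ = ⊥-elim (∉⊥ x∈)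
x∈⋃⁻ (q List.∷ ps) x∈ with x∈p∪q⁻ q (⋃ ps) x∈
... | inj₁ x∈q = q , Any.here refl , x∈q
... | inj₂ x∈⋃ps with x∈⋃⁻ ps x∈⋃ps
...   | p , p∈ps , x∈p = p , Any.there p∈ps , x∈p

x∈⋃tabulate⁺ : ∀ {L} {x : Fin n} (ps : Fin L → Subset n) i → x ∈ ps i → x ∈ ⋃ (tabulate ps)
x∈⋃tabulate⁺ ps i x∈ = x∈⋃⁺ x∈ (∈-tabulate⁺ i)

x∈⋃tabulate⁻ : ∀ {L} {x : Fin n} (ps : Fin L → Subset n) → x ∈ ⋃ (tabulate ps) → ∃[ i ] x ∈ ps i
x∈⋃tabulate⁻ ps x∈ with x∈⋃⁻ (tabulate ps) x∈
... | p , p∈ , x∈p with ∈-tabulate⁻ p∈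
...   | i , refl = i , x∈p

∣p∣≡3⇒∣p─q∣≤1 : ∀ {p q : Subset n} {a c} → ∣ p ∣ ≡ 3 → a ∈ p → c ∈ p → c ≢ a → a ∈ q → c ∈ q → ∣ p ─ q ∣ ≤ 1
∣p∣≡3⇒∣p─q∣≤1 {p = p} {q} {a} {c} ∣p∣≡3 a∈p c∈p c≢a a∈q c∈q =
  ≤-trans (p⊆q⇒∣p∣≤∣q∣ p─q⊆p-a-c) (≤-reflexive ∣p-a-c∣≡1)
  where
  p─q⊆p-a-c : p ─ q ⊆ p - a - c
  p─q⊆p-a-c y∈ with x∈p─q⁻ y∈
  ... | y∈p , y∉q = x∈p∧x≢y⇒x∈p-y (x∈p∧x≢y⇒x∈p-y y∈p λ { refl → y∉q a∈q }) λ { refl → y∉q c∈q }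
  ∣p-a-c∣≡1 : ∣ p - a - c ∣ ≡ 1
  ∣p-a-c∣≡1 = suc-injective (suc-injective (begin
    suc (suc ∣ p - a - c ∣)  ≡⟨ cong suc (∣p∣≡1+∣p-x∣ (p - a) (x∈p∧x≢y⇒x∈p-y c∈p c≢a)) ⟨
    suc ∣ p - a ∣            ≡⟨ ∣p∣≡1+∣p-x∣ p a∈p ⟨
    ∣ p ∣                    ≡⟨ ∣p∣≡3 ⟩
    3                        ∎))
    where open ≡-Reasoning

p⊆q⇒p─r⊆q─r : ∀ {p q r : Subset n} → p ⊆ q → p ─ r ⊆ q ─ r
p⊆q⇒p─r⊆q─r p⊆q x∈ with x∈p─q⁻ x∈
... | x∈p , x∉r = x∈p∧x∉q⇒x∈p─q (p⊆q x∈p) x∉r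

-- Moves

move : Fin n → Fin n → MHG n → MHG n
move x y H = del y (mark x H)

module Mark (H : MHG n) (x : Fin n) where

  unmarked⁻ : ∀ {z} → z ∈ NonMarked (mark x H) → z ∈ NonMarked H × z ≢ x
  unmarked⁻ z∈ with x∈p─q⁻ z∈
  ... | z∈V , z∉M = x∈p∧x∉q⇒x∈p─q z∈V (z∉M ∘′ p⊆p∪q _) , λ { refl → z∉M (q⊆p∪q _ _ (x∈⁅x⁆ x)) }

  unmarked⁺ : ∀ {z} → z ∈ NonMarked H → z ≢ x → z ∈ NonMarked (mark x H)
  unmarked⁺ z∈ z≢x with x∈p─q⁻ z∈
  ... | z∈V , z∉M = x∈p∧x∉q⇒x∈p─q z∈V λ z∈M∪x →
    [ z∉M , (λ z∈⁅x⁆ → z≢x (x∈⁅y⁆⇒x≡y x z∈⁅x⁆)) ]′ (x∈p∪q⁻ (M H) ⁅ x ⁆ z∈M∪x)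

module Move (H : MHG n) (x y : Fin n) where

  vertex⁻ : ∀ {z} → z ∈ V (move x y H) → z ∈ V H × z ≢ y
  vertex⁻ = x∈p-y⁻

  marked⁻ : ∀ {z} → z ∈ M (move x y H) → z ∈ M H ⊎ z ≡ x
  marked⁻ z∈ with x∈p∪q⁻ (M H) ⁅ x ⁆ (proj₁ (x∈p-y⁻ z∈))
  ... | inj₁ z∈M = inj₁ z∈M
  ... | inj₂ z∈⁅x⁆ = inj₂ (x∈⁅y⁆⇒x≡y x z∈⁅x⁆)

  marked⁺ : ∀ {z} → z ∈ M H → z ≢ y → z ∈ M (move x y H)
  marked⁺ z∈M z≢y = x∈p∧x≢y⇒x∈p-y (p⊆p∪q _ z∈M) z≢y

  played : x ≢ y → x ∈ M (move x y H)
  played = x∈p∧x≢y⇒x∈p-y (q⊆p∪q _ _ (x∈⁅x⁆ x))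

  answered : y ∈ NonMarked (mark x H) → x ∈ M (move x y H)
  answered y∈ = played (proj₂ (Mark.unmarked⁻ H x y∈) ∘′ sym)

  unmarked⁻ : ∀ {z} → z ∈ NonMarked (move x y H) → z ∈ NonMarked H × z ≢ x × z ≢ y
  unmarked⁻ z∈ with x∈p─q⁻ z∈
  ... | z∈V′ , z∉M′ with vertex⁻ z∈V′
  ...   | z∈V , z≢y = x∈p∧x∉q⇒x∈p─q z∈V (λ z∈M → z∉M′ (marked⁺ z∈M z≢y))
                    , (λ { refl → z∉M′ (played z≢y) }) , z≢y

  unmarked⁺ : ∀ {z} → z ∈ NonMarked H → z ≢ x → z ≢ y → z ∈ NonMarked (move x y H)
  unmarked⁺ z∈ z≢x z≢y with x∈p─q⁻ z∈
  ... | z∈V , z∉M = x∈p∧x∉q⇒x∈p─q (x∈p∧x≢y⇒x∈p-y z∈V z≢y) λ z∈M′ → [ z∉M , z≢x ]′ (marked⁻ z∈M′)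

  free⁻ : ∀ {e} → y ∉ e → e ─ M (move x y H) ⊆ e ─ M H
  free⁻ y∉e z∈ with x∈p─q⁻ z∈
  ... | z∈e , z∉M′ = x∈p∧x∉q⇒x∈p─q z∈e λ z∈M → z∉M′ (marked⁺ z∈M λ { refl → y∉e z∈e })

  free⁺ : ∀ {e z} → z ∈ e ─ M H → z ≢ x → z ∈ e ─ M (move x y H)
  free⁺ z∈ z≢x with x∈p─q⁻ z∈
  ... | z∈e , z∉M = x∈p∧x∉q⇒x∈p─q z∈e λ z∈M′ → [ z∉M , z≢x ]′ (marked⁻ z∈M′)

  edge⁺ : ∀ {e} → e ∈ₗ E H → y ∉ e → e ∈ₗ E (move x y H)
  edge⁺ e∈ y∉e = ∈-filter⁺ (λ e → ¬? (y ∈? e)) e∈ y∉e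

  edge⁻ : ∀ {e} → e ∈ₗ E (move x y H) → e ∈ₗ E H × y ∉ e
  edge⁻ = ∈-filter⁻ (λ e → ¬? (y ∈? e))

  shrinks : x ∈ NonMarked H → ∣ NonMarked (move x y H) ∣ < ∣ NonMarked H ∣
  shrinks x∈ = p⊂q⇒∣p∣<∣q∣ ((proj₁ ∘′ unmarked⁻) , x , x∈ , λ x∈′ → proj₁ (proj₂ (unmarked⁻ x∈′)) refl)

_≺_ : MHG n → MHG n → Set
H′ ≺ H = ∣ NonMarked H′ ∣ < ∣ NonMarked H ∣

≺-wellFounded : WellFounded (_≺_ {n = n})
≺-wellFounded = On.wellFounded (λ H → ∣ NonMarked H ∣) <-wellFounded

≺-rec : (P : MHG n → Set) → (∀ H → (∀ {H′} → H′ ≺ H → P H′) → P H) → ∀ H → P H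
≺-rec = WF.All.wfRec ≺-wellFounded 0ℓ

-- Paths

module Path {k} {es : Fin (suc k) → Subset n} {a b} (ps : PathSeq k es a b) where

  edge-size : ∀ i → ∣ es i ∣ ≡ 3
  edge-size = proj₁ ps

  consecutive : ∀ i j → toℕ j ≡ suc (toℕ i) → ∣ es i ∩ es j ∣ ≡ 1
  consecutive = proj₁ (proj₂ ps)

  distant : ∀ i j → 2 + toℕ i ≤ toℕ j → Empty (es i ∩ es j)
  distant = proj₁ (proj₂ (proj₂ ps))

  ends-distinct : a ≢ b
  ends-distinct = proj₁ (proj₂ (proj₂ (proj₂ ps)))

  start∈first : a ∈ es fz
  start∈first = proj₁ (proj₂ (proj₂ (proj₂ (proj₂ ps))))

  start∉later : ∀ i → 1 ≤ toℕ i → a ∉ es i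
  start∉later = proj₁ (proj₂ (proj₂ (proj₂ (proj₂ (proj₂ ps)))))

  end∈last : b ∈ es (fromℕ k)
  end∈last = proj₁ (proj₂ (proj₂ (proj₂ (proj₂ (proj₂ (proj₂ ps))))))

  end∉earlier : ∀ i → toℕ i < k → b ∉ es i
  end∉earlier = proj₂ (proj₂ (proj₂ (proj₂ (proj₂ (proj₂ (proj₂ ps))))))

module Junction {k} {es : Fin (suc (suc k)) → Subset n} {a b} (ps : PathSeq (suc k) es a b) where
  open Path ps

  junction : Fin n
  junction = proj₁ (0<∣p∣⇒Nonempty (es fz ∩ es (fs fz)) (≤-reflexive (sym (consecutive fz (fs fz) refl))))

  junction∈first×second : junction ∈ es fz × junction ∈ es (fs fz)
  junction∈first×second =
    x∈p∩q⁻ _ _ (proj₂ (0<∣p∣⇒Nonempty (es fz ∩ es (fs fz)) (≤-reflexive (sym (consecutive fz (fs fz) refl)))))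

  junction≢start : junction ≢ a
  junction≢start c≡a = start∉later (fs fz) (s≤s z≤n) (subst (_∈ es (fs fz)) c≡a (proj₂ junction∈first×second))

  first∩later⊆junction : ∀ {y} i → y ∈ es fz → y ∈ es (fs i) → y ≡ junction
  first∩later⊆junction fz y∈₀ y∈₁ =
    ∣p∣≡1⇒x≡y _ (consecutive fz (fs fz) refl) (x∈p∩q⁺ junction∈first×second) (x∈p∩q⁺ (y∈₀ , y∈₁))
  first∩later⊆junction (fs i) y∈₀ y∈ = ⊥-elim (distant fz (fs (fs i)) (s≤s (s≤s z≤n)) (_ , x∈p∩q⁺ (y∈₀ , y∈)))

  tail : PathSeq k (es ∘′ fs) junction b
  tail = (λ i → edge-size (fs i))
       , (λ i j j≡1+i → consecutive (fs i) (fs j) (cong suc j≡1+i))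
       , (λ i j 2+i≤j → distant (fs i) (fs j) (s≤s 2+i≤j))
       , (λ c≡b → end∉earlier fz (s≤s z≤n) (subst (_∈ es fz) c≡b (proj₁ junction∈first×second)))
       , proj₂ junction∈first×second
       , (λ i 1≤i c∈ → distant fz (fs i) (s≤s 1≤i) (junction , x∈p∩q⁺ (proj₁ junction∈first×second , c∈)))
       , end∈last
       , (λ i i<k → end∉earlier (fs i) (s≤s i<k))

singlePath : ∀ {e : Subset n} {a b} → ∣ e ∣ ≡ 3 → a ∈ e → b ∈ e → a ≢ b → PathSeq 0 (λ _ → e) a b
singlePath ∣e∣≡3 a∈e b∈e a≢b =
  (λ _ → ∣e∣≡3) , (λ { fz fz () }) , (λ { fz fz () }) , a≢b , a∈e , (λ { fz () }) , b∈e , (λ { fz () })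

consPath : ∀ {k} {es : Fin (suc k) → Subset n} {e a b c} → PathSeq k es c b →
  ∣ e ∣ ≡ 3 → ∣ e ∩ es fz ∣ ≡ 1 → (∀ i → 1 ≤ toℕ i → Empty (e ∩ es i)) →
  a ∈ e → (∀ i → a ∉ es i) → b ∉ e → PathSeq (suc k) (e ∷ᶠ es) a b
consPath {es = es} {e} ps ∣e∣≡3 ∣e∩e₀∣≡1 e∩later a∈e a∉ b∉e =
  size , linked , apart , (λ { refl → b∉e a∈e }) , a∈e , (λ { (fs i) _ → a∉ i })
  , end∈last , (λ { fz _ → b∉e ; (fs i) 1+i<1+k → end∉earlier i (≤-pred 1+i<1+k) })
  where
  open Path ps
  size : ∀ i → ∣ (e ∷ᶠ es) i ∣ ≡ 3
  size fz = ∣e∣≡3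
  size (fs i) = edge-size i
  linked : ∀ i j → toℕ j ≡ suc (toℕ i) → ∣ (e ∷ᶠ es) i ∩ (e ∷ᶠ es) j ∣ ≡ 1
  linked fz (fs fz) _ = ∣e∩e₀∣≡1
  linked fz (fs (fs j)) ()
  linked (fs i) (fs j) j≡1+i = consecutive i j (suc-injective j≡1+i)
  apart : ∀ i j → 2 + toℕ i ≤ toℕ j → Empty ((e ∷ᶠ es) i ∩ (e ∷ᶠ es) j)
  apart fz (fs j) (s≤s 1≤j) = e∩later j 1≤j
  apart (fs i) (fs j) (s≤s 2+i≤j) = distant i j 2+i≤j

-- Maker's wins

-- Maker takes the last free vertex of e if there is one; otherwise every move is as good.
safeMove : ∀ (H : MHG n) {e} → ∣ e ─ M H ∣ ≤ 1 → 0 < ∣ NonMarked H ∣ →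
           ∃[ x ] (x ∈ NonMarked H × ∀ {y} → y ∈ NonMarked (mark x H) → y ∉ e)
safeMove H {e} ∣e─M∣≤1 0<∣NM∣ with nonempty? ((e ─ M H) ∩ NonMarked H)
... | yes (z , z∈) = z , proj₂ (x∈p∩q⁻ _ _ z∈) , λ y∈ y∈e →
  let y∈NM , y≢z = Mark.unmarked⁻ H z y∈ in
  y≢z (∣p∣≤1⇒x≡y _ ∣e─M∣≤1 (proj₁ (x∈p∩q⁻ _ _ z∈)) (x∈p∧x∉q⇒x∈p─q y∈e (proj₂ (x∈p─q⁻ y∈NM))))
... | no none = let x , x∈ = 0<∣p∣⇒Nonempty (NonMarked H) 0<∣NM∣ in
  x , x∈ , λ y∈ y∈e → let y∈NM = proj₁ (Mark.unmarked⁻ H x y∈) in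
  none (_ , x∈p∩q⁺ (x∈p∧x∉q⇒x∈p─q y∈e (proj₂ (x∈p─q⁻ y∈NM)) , y∈NM))

nearlyMarked⇒MakerWin : ∀ (H : MHG n) {e} → e ∈ₗ E H → ∣ e ─ M H ∣ ≤ 1 → MakerWin H
nearlyMarked⇒MakerWin = ≺-rec Goal win
  where
  Goal : MHG _ → Set
  Goal H = ∀ {e} → e ∈ₗ E H → ∣ e ─ M H ∣ ≤ 1 → MakerWin H
  win : ∀ H → (∀ {H′} → H′ ≺ H → Goal H′) → Goal H
  win H ih {e} e∈ ∣e─M∣≤1 with ∣ NonMarked H ∣ ≤? 1
  ... | yes small = base small (e , e∈ , ∣e─M∣≤1)
  ... | no large with safeMove H ∣e─M∣≤1 (<-≤-trans (s≤s z≤n) (≰⇒> large))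
  ...   | x , x∈ , avoids = step (≰⇒> large) x x∈ λ y y∈ →
          ih (Move.shrinks H x y x∈) (Move.edge⁺ H x y e∈ (avoids y∈))
             (≤-trans (p⊆q⇒∣p∣≤∣q∣ (Move.free⁻ H x y (avoids y∈))) ∣e─M∣≤1)

markedPath⇒MakerWin : ∀ k (H : MHG n) {es a b} → PathSeq k es a b → (∀ i → es i ∈ₗ E H) →
                      (∀ i → es i ⊆ V H) → a ∈ M H → b ∈ M H → MakerWin H
markedPath⇒MakerWin zero H ps es∈ _ a∈M b∈M =
  nearlyMarked⇒MakerWin H (es∈ fz)
    (∣p∣≡3⇒∣p─q∣≤1 (edge-size fz) start∈first end∈last (ends-distinct ∘′ sym) a∈M b∈M)
  where open Path ps
markedPath⇒MakerWin (suc k) H {es} ps es∈ es⊆V a∈M b∈M = byJunction (c ∈? M H) (∣ NonMarked H ∣ ≤? 1)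
  where
  open Path ps
  open Junction ps renaming (junction to c)
  c∈e₀ : c ∈ es fz
  c∈e₀ = proj₁ junction∈first×second
  byJunction : Dec (c ∈ M H) → Dec (∣ NonMarked H ∣ ≤ 1) → MakerWin H
  byJunction (yes c∈M) _ = nearlyMarked⇒MakerWin H (es∈ fz)
    (∣p∣≡3⇒∣p─q∣≤1 (edge-size fz) start∈first c∈e₀ junction≢start a∈M c∈M)
  byJunction (no c∉M) (yes small) =
    base small (es fz , es∈ fz , ≤-trans (p⊆q⇒∣p∣≤∣q∣ (p⊆q⇒p─r⊆q─r {r = M H} (es⊆V fz))) small)
  byJunction (no c∉M) (no large) = step (≰⇒> large) c (x∈p∧x∉q⇒x∈p─q (es⊆V fz c∈e₀) c∉M) answer
    where
    answer : ∀ y → y ∈ NonMarked (mark c H) → MakerWin (move c y H)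
    answer y y∈ with y ∈? es fz
    ... | no y∉e₀ = nearlyMarked⇒MakerWin (move c y H) (Move.edge⁺ H c y (es∈ fz) y∉e₀)
          (∣p∣≡3⇒∣p─q∣≤1 (edge-size fz) start∈first c∈e₀ junction≢start
            (Move.marked⁺ H c y a∈M λ { refl → y∉e₀ start∈first }) (Move.answered H c y y∈))
    ... | yes y∈e₀ = markedPath⇒MakerWin k (move c y H) tail
          (λ i → Move.edge⁺ H c y (es∈ (fs i)) (y∉later i))
          (λ i z∈ → x∈p∧x≢y⇒x∈p-y (es⊆V (fs i) z∈) λ { refl → y∉later i z∈ })
          (Move.answered H c y y∈) (Move.marked⁺ H c y b∈M λ { refl → y∉later (fromℕ k) end∈last })
      where
      y∉later : ∀ i → y ∉ es (fs i)
      y∉later i y∈eᵢ = proj₂ (Mark.unmarked⁻ H c y∈) (first∩later⊆junction i y∈e₀ y∈eᵢ)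

trivialMakerWin? : ∀ (H : MHG n) → Dec (TrivialMakerWin H)
trivialMakerWin? H = map′ find (λ { (e , e∈ , small) → lose e∈ small }) (Any.any? (λ e → ∣ e ─ M H ∣ ≤? 1) (E H))

makerWin? : ∀ (H : MHG n) → Dec (MakerWin H)
makerWin? = ≺-rec (λ H → Dec (MakerWin H)) decide
  where
  decide : ∀ H → (∀ {H′} → H′ ≺ H → Dec (MakerWin H′)) → Dec (MakerWin H)
  decide H ih with ∣ NonMarked H ∣ ≤? 1
  ... | yes small = map′ (base small)
        (λ { (base _ trivial) → trivial ; (step large _ _ _) → contradiction large (≤⇒≯ small) })
        (trivialMakerWin? H)
  ... | no large = map′ (λ (x , x∈ , wins) → step (≰⇒> large) x x∈ wins)
        (λ { (base small _) → contradiction small large ; (step _ x x∈ wins) → x , x∈ , wins })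
        (Finₚ.any? winningMove?)
    where
    winningMove? : ∀ x → Dec (x ∈ NonMarked H × (∀ y → y ∈ NonMarked (mark x H) → MakerWin (move x y H)))
    winningMove? x with x ∈? NonMarked H
    ... | no x∉ = no (x∉ ∘′ proj₁)
    ... | yes x∈ = map′ (x∈ ,_) proj₂
          (Finₚ.all? λ y → (y ∈? NonMarked (mark x H)) →-dec ih (Move.shrinks H x y x∈))

-- Snakes

record SnakeIn (H X : MHG n) (x : Fin n) : Set where
  field
    len : ℕ
    edges : Fin (suc len) → Subset n
    end : Fin n
    path : PathSeq len edges x end
    edge∈E : ∀ i → edges i ∈ₗ E H
    edge⊆X : ∀ i → edges i ⊆ V X
    X⊆V : V X ⊆ V H
    end∈M : end ∈ M H
    end∈X : end ∈ V X
    onlyMarked : ∀ {z} → z ∈ V X → z ∈ M H → z ≡ end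

snakeIn : ∀ {H X : MHG n} {x} → InxS H x X → SnakeIn H X x
snakeIn {H = H} {X} ((_ , X⊆V , E⊆E , MX≡) , _ , _ , (m , m∈MX , (k , es , ps , (es∈ , _ , VX≡))) , ∣MX∣≡1) = record
  { len = k
  ; edges = es
  ; end = m
  ; path = ps
  ; edge∈E = λ i → E⊆E _ (es∈ i)
  ; edge⊆X = λ i z∈ → subst (_ ∈_) (sym VX≡) (x∈⋃tabulate⁺ es i z∈)
  ; X⊆V = X⊆V
  ; end∈M = proj₂ m∈V∩M
  ; end∈X = proj₁ m∈V∩M
  ; onlyMarked = λ z∈V z∈M → ∣p∣≡1⇒x≡y (M X) ∣MX∣≡1 m∈MX (subst (_ ∈_) (sym MX≡) (x∈p∩q⁺ (z∈V , z∈M)))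
  }
  where
  m∈V∩M : m ∈ V X × m ∈ M H
  m∈V∩M = x∈p∩q⁻ (V X) (M H) (subst (m ∈_) MX≡ m∈MX)

breakerWin⇒J1 : ∀ (H : MHG n) → 2 ≤ ∣ NonMarked H ∣ → BreakerWin H → J1 H
breakerWin⇒J1 {n} H large breakerWins x x∈
  with Finₚ.¬∀⟶∃¬ n _ (λ y → (y ∈? NonMarked (mark x H)) →-dec makerWin? (move x y H))
                       (λ wins → breakerWins (step large x x∈ wins))
... | y , ¬wins with y ∈? NonMarked (mark x H)
...   | no y∉ = contradiction (λ y∈ → contradiction y∈ y∉) ¬wins
...   | yes y∈ = y , y∈ , λ X snake → decidable-stable (y ∈? V X) λ y∉X → ¬wins λ _ →
        let open SnakeIn (snakeIn snake)
            y∉edge : ∀ i → y ∉ edges i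
            y∉edge i = y∉X ∘′ edge⊆X i
        in markedPath⇒MakerWin len (move x y H) path
             (λ i → Move.edge⁺ H x y (edge∈E i) (y∉edge i))
             (λ i z∈ → x∈p∧x≢y⇒x∈p-y (X⊆V (edge⊆X i z∈)) λ { refl → y∉edge i z∈ })
             (Move.answered H x y y∈)
             (Move.marked⁺ H x y end∈M λ { refl → y∉X end∈X })

-- Walks

clamp : ∀ k → ℕ → Fin (suc k)
clamp k zero = fz
clamp zero (suc i) = fz
clamp (suc k) (suc i) = fs (clamp k i)

toℕ-clamp : ∀ {k i} → i ≤ k → toℕ (clamp k i) ≡ i
toℕ-clamp {i = zero} _ = refl
toℕ-clamp {suc k} {suc i} (s≤s i≤k) = cong suc (toℕ-clamp i≤k)

clamp-self : ∀ k → clamp k k ≡ fromℕ k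
clamp-self zero = refl
clamp-self (suc k) = cong fs (clamp-self k)

-- The last edge of pathWalk ps valid below is es (clamp k k).
pathWalk-end : ∀ {k} {es : Fin (suc k) → Subset n} {a b} → PathSeq k es a b → b ∈ es (clamp k k)
pathWalk-end {k = k} {es} {b = b} ps = subst (b ∈_) (cong es (sym (clamp-self k))) (Path.end∈last ps)

-- The edges of a walk are indexed by ℕ; only the indices 0 … len matter.
record Walk (P : Subset n → Set) : Set where
  field
    len : ℕ
    edge : ℕ → Subset n
    linked : ∀ i → i < len → Nonempty (edge i ∩ edge (suc i))
    valid : ∀ i → i ≤ len → P (edge i)

  first last : Subset n
  first = edge 0
  last = edge len

open Walk using (first; last)

module _ {P : Subset n → Set} where

  pathWalk : ∀ {k es a b} → PathSeq k es a b → (∀ t → P (es t)) → Walk P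
  pathWalk {k} {es} ps valid = record
    { len = k
    ; edge = es ∘′ clamp k
    ; linked = λ i i<k → 0<∣p∣⇒Nonempty _ (≤-reflexive (sym (Path.consecutive ps (clamp k i) (clamp k (suc i))
                 (trans (toℕ-clamp i<k) (cong suc (sym (toℕ-clamp (<⇒≤ i<k))))))))
    ; valid = λ i _ → valid (clamp k i)
    }

  reverseWalk : Walk P → Walk P
  reverseWalk w = record
    { len = len
    ; edge = λ i → edge (len ∸ i)
    ; linked = λ i i<len → subst (λ j → Nonempty (edge j ∩ edge (len ∸ suc i))) (sym (∸-suc i<len))
                 (subst Nonempty (∩-comm _ _) (linked (len ∸ suc i) (∸-suc< i<len)))
    ; valid = λ i _ → valid (len ∸ i) (m∸n≤m len i)
    }
    where
    open Walk w
    ∸-suc : ∀ {L i} → i < L → L ∸ i ≡ suc (L ∸ suc i)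
    ∸-suc {suc L} {zero} _ = refl
    ∸-suc {suc L} {suc i} (s≤s i<L) = ∸-suc i<L
    ∸-suc< : ∀ {L i} → i < L → L ∸ suc i < L
    ∸-suc< {suc L} {i} (s≤s _) = s≤s (m∸n≤m L i)

  reverseWalk-last : ∀ w {z} → z ∈ first w → z ∈ last (reverseWalk w)
  reverseWalk-last w {z} = subst (λ i → z ∈ Walk.edge w i) (sym (n∸n≡0 (Walk.len w)))

  append : (ℕ → Subset n) → ℕ → (ℕ → Subset n) → ℕ → Subset n
  append u L v zero = u zero
  append u zero v (suc i) = v i
  append u (suc L) v (suc i) = append (u ∘′ suc) L v i

  append-linked : ∀ u L v Lv → (∀ i → i < L → Nonempty (u i ∩ u (suc i))) →
                  (∀ i → i < Lv → Nonempty (v i ∩ v (suc i))) → Nonempty (u L ∩ v 0) →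
                  ∀ i → i < suc L + Lv → Nonempty (append u L v i ∩ append u L v (suc i))
  append-linked u zero v Lv _ _ junction zero _ = junction
  append-linked u zero v Lv _ linkedᵥ _ (suc i) (s≤s i<Lv) = linkedᵥ i i<Lv
  append-linked u (suc L) v Lv linkedᵤ _ _ zero _ = linkedᵤ 0 (s≤s z≤n)
  append-linked u (suc L) v Lv linkedᵤ linkedᵥ junction (suc i) (s≤s i<) =
    append-linked (u ∘′ suc) L v Lv (λ i i<L → linkedᵤ (suc i) (s≤s i<L)) linkedᵥ junction i i<

  append-valid : ∀ u L v Lv → (∀ i → i ≤ L → P (u i)) → (∀ i → i ≤ Lv → P (v i)) →
                 ∀ i → i ≤ suc L + Lv → P (append u L v i)
  append-valid u L v Lv validᵤ _ zero _ = validᵤ 0 z≤n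
  append-valid u zero v Lv _ validᵥ (suc i) (s≤s i≤Lv) = validᵥ i i≤Lv
  append-valid u (suc L) v Lv validᵤ validᵥ (suc i) (s≤s i≤) =
    append-valid (u ∘′ suc) L v Lv (λ i i≤L → validᵤ (suc i) (s≤s i≤L)) validᵥ i i≤

  append-end : ∀ u L v Lv → append u L v (suc L + Lv) ≡ v Lv
  append-end u zero v Lv = refl
  append-end u (suc L) v Lv = append-end (u ∘′ suc) L v Lv

  joinWalks : (u v : Walk P) → Nonempty (last u ∩ first v) → Walk P
  joinWalks u v junction = record
    { len = suc (Walk.len u) + Walk.len v
    ; edge = append (Walk.edge u) (Walk.len u) (Walk.edge v)
    ; linked = append-linked _ (Walk.len u) _ (Walk.len v) (Walk.linked u) (Walk.linked v) junction
    ; valid = append-valid _ (Walk.len u) _ (Walk.len v) (Walk.valid u) (Walk.valid v)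
    }

  joinWalks-last : ∀ u v junction {z} → z ∈ last v → z ∈ last (joinWalks u v junction)
  joinWalks-last u v _ {z} = subst (z ∈_) (sym (append-end (Walk.edge u) (Walk.len u) (Walk.edge v) (Walk.len v)))

record Greatest (Q : ℕ → Set) (i L : ℕ) : Set where
  field
    index : ℕ
    i≤index : i ≤ index
    index≤L : index ≤ L
    holds : Q index
    beyond : ∀ j → index < j → j ≤ L → ¬ Q j

greatest : (Q : ℕ → Set) → (∀ j → Dec (Q j)) → ∀ L {i} → i ≤ L → Q i → Greatest Q i L
greatest Q Q? zero z≤n Qi = record { index = zero ; i≤index = z≤n ; index≤L = z≤n ; holds = Qi ; beyond = λ { _ () z≤n } }
greatest Q Q? (suc L) {i} i≤1+L Qi with Q? (suc L) | i ≟ℕ suc L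
... | yes Q1+L | _ = record { index = suc L ; i≤index = i≤1+L ; index≤L = ≤-refl ; holds = Q1+L
                            ; beyond = λ j 1+L<j j≤1+L → contradiction (≤-trans 1+L<j j≤1+L) (<-irrefl refl) }
... | no ¬Q1+L | yes refl = contradiction Qi ¬Q1+L
... | no ¬Q1+L | no i≢1+L = record { Greatest below ; index≤L = ≤-trans index≤L (n≤1+n L) ; beyond = beyond′ }
  where
  below : Greatest Q i L
  below = greatest Q Q? L (≤-pred (≤∧≢⇒< i≤1+L i≢1+L)) Qi
  open Greatest below
  beyond′ : ∀ j → index < j → j ≤ suc L → ¬ Q j
  beyond′ j index<j j≤1+L with j ≟ℕ suc L
  ... | yes refl = ¬Q1+L
  ... | no j≢1+L = beyond j index<j (≤-pred (≤∧≢⇒< j≤1+L j≢1+L))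

record PathFrom (P : Subset n → Set) (A : Subset n) (b : Fin n) : Set where
  field
    len : ℕ
    edges : Fin (suc len) → Subset n
    start : Fin n
    path : PathSeq len edges start b
    start∈A : start ∈ A
    valid : ∀ t → P (edges t)
    later∩A : ∀ t → 1 ≤ toℕ t → Empty (edges t ∩ A)

-- Shortcutting a walk: from the last edge meeting A jump to the last edge meeting the current one.
-- Linearity makes consecutive jumps meet in one vertex, maximality makes non-consecutive ones disjoint.
module Shortcut {P : Subset n → Set} (size : ∀ {e} → P e → ∣ e ∣ ≡ 3)
  (linear : ∀ {e f} → P e → P f → e ≢ f → Nonempty (e ∩ f) → ∣ e ∩ f ∣ ≡ 1)
  (w : Walk P) {b : Fin n} (b∈last : b ∈ last w) where

  open Walk w hiding (first; last)

  record PathFromEdge (A : Subset n) (i : ℕ) : Set where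
    field
      len′ : ℕ
      edges′ : Fin (suc len′) → Subset n
      start : Fin n
      path : PathSeq len′ edges′ start b
      start∈A : start ∈ A
      first≡ : edges′ fz ≡ edge i
      edges≡ : ∀ t → ∃[ j ] (i ≤ j × j ≤ len × edges′ t ≡ edge j)
      later≡ : ∀ t → 1 ≤ toℕ t → ∃[ j ] (i < j × j ≤ len × edges′ t ≡ edge j)

  fromEdge : ∀ bound (A : Subset n) → b ∉ A → ∀ i → i ≤ len → len < i + bound → Nonempty (edge i ∩ A) →
             (∀ j → i < j → j ≤ len → Empty (edge j ∩ A)) → PathFromEdge A i
  fromEdge zero A _ i i≤len len<i+0 _ _ = contradiction (subst (_ <_) (+-identityʳ i) len<i+0) (≤⇒≯ i≤len)
  fromEdge (suc bound) A b∉A i i≤len len<i+bound (a , a∈) A-last with b ∈? edge i | x∈p∩q⁻ (edge i) A a∈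
  ... | yes b∈eᵢ | a∈eᵢ , a∈A = record
    { len′ = 0 ; edges′ = λ _ → edge i ; start = a
    ; path = singlePath (size (valid i i≤len)) a∈eᵢ b∈eᵢ λ { refl → b∉A a∈A }
    ; start∈A = a∈A ; first≡ = refl
    ; edges≡ = λ _ → i , ≤-refl , i≤len , refl ; later≡ = λ { fz () } }
  ... | no b∉eᵢ | a∈eᵢ , a∈A = record
    { len′ = suc len′ ; edges′ = edge i ∷ᶠ edges′ ; start = a
    ; path = consPath path (size (valid i i≤len)) ∣eᵢ∩e′∣≡1 eᵢ∩later a∈eᵢ a∉rest b∉eᵢ
    ; start∈A = a∈A ; first≡ = refl
    ; edges≡ = λ { fz → i , ≤-refl , i≤len , refl
                 ; (fs t) → let j′ , j≤j′ , j′≤len , eq = edges≡ t in j′ , ≤-trans (<⇒≤ i<j) j≤j′ , j′≤len , eq }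
    ; later≡ = λ { (fs t) _ → let j′ , j≤j′ , j′≤len , eq = edges≡ t in j′ , <-≤-trans i<j j≤j′ , j′≤len , eq } }
    where
    i<len : i < len
    i<len = ≤∧≢⇒< i≤len λ { refl → b∉eᵢ b∈last }
    open Greatest (greatest (λ j → Nonempty (edge i ∩ edge j)) (λ j → nonempty? (edge i ∩ edge j)) len i<len (linked i i<len))
      renaming (index to j; i≤index to i<j; index≤L to j≤len; holds to eᵢ∩eⱼ)
    eᵢ≢eⱼ : edge i ≢ edge j
    eᵢ≢eⱼ eᵢ≡eⱼ with j ≟ℕ len
    ... | yes j≡len = b∉eᵢ (subst (b ∈_) (sym eᵢ≡eⱼ) (subst (λ j → b ∈ edge j) (sym j≡len) b∈last))
    ... | no j≢len = beyond (suc j) ≤-refl j<len (subst (λ e → Nonempty (e ∩ edge (suc j))) (sym eᵢ≡eⱼ) (linked j j<len))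
      where j<len = ≤∧≢⇒< j≤len j≢len
    open PathFromEdge (fromEdge bound (edge i) b∉eᵢ j j≤len
      (≤-trans (subst (suc len ≤_) (+-suc i bound) len<i+bound) (+-monoˡ-≤ bound i<j))
      (subst Nonempty (∩-comm _ _) eᵢ∩eⱼ)
      (λ j′ j<j′ j′≤len → beyond j′ j<j′ j′≤len ∘′ subst Nonempty (∩-comm _ _)))
    ∣eᵢ∩e′∣≡1 : ∣ edge i ∩ edges′ fz ∣ ≡ 1
    ∣eᵢ∩e′∣≡1 rewrite first≡ = linear (valid i i≤len) (valid j j≤len) eᵢ≢eⱼ eᵢ∩eⱼ
    eᵢ∩later : ∀ t → 1 ≤ toℕ t → Empty (edge i ∩ edges′ t)
    eᵢ∩later t 1≤t with later≡ t 1≤t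
    ... | j′ , j<j′ , j′≤len , eq rewrite eq = beyond j′ j<j′ j′≤len
    a∉rest : ∀ t → a ∉ edges′ t
    a∉rest t a∈eₜ with edges≡ t
    ... | j′ , j≤j′ , j′≤len , eq rewrite eq = A-last j′ (<-≤-trans i<j j≤j′) j′≤len (a , x∈p∩q⁺ (a∈eₜ , a∈A))

  fromStart : ∀ (A : Subset n) → b ∉ A → Nonempty (first w ∩ A) → PathFrom P A b
  fromStart A b∉A first∩A = record
    { len = len′ ; edges = edges′ ; start = start ; path = path ; start∈A = start∈A
    ; valid = λ t → let j , _ , j≤len , eq = edges≡ t in subst P (sym eq) (valid j j≤len)
    ; later∩A = λ t 1≤t → let j , i<j , j≤len , eq = later≡ t 1≤t in subst (λ e → Empty (e ∩ A)) (sym eq) (A-last j i<j j≤len)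
    }
    where
    open Greatest (greatest (λ j → Nonempty (edge j ∩ A)) (λ j → nonempty? (edge j ∩ A)) len z≤n first∩A)
      renaming (index to i; index≤L to i≤len; holds to eᵢ∩A; beyond to A-last)
    open PathFromEdge (fromEdge (suc len) A b∉A i i≤len (subst (len <_) (sym (+-suc i len)) (s≤s (m≤n+m len i)))
                        eᵢ∩A A-last)

-- Hyperforests

module _ {H : MHG n} (wf : WF H) where

  edge-nonempty : ∀ {e} → e ∈ₗ E H → Nonempty e
  edge-nonempty e∈ = proj₁ (All.lookup (proj₁ (proj₂ wf)) e∈)

  edge⊆V : ∀ {e} → e ∈ₗ E H → e ⊆ V H
  edge⊆V e∈ = proj₂ (All.lookup (proj₁ (proj₂ wf)) e∈)

spanned : ∀ {L} → MHG n → (Fin L → Subset n) → MHG n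
spanned H es = mhg (⋃ (tabulate es)) (tabulate es) (⋃ (tabulate es) ∩ M H)

spanned-isSub : ∀ {H : MHG n} {L} → WF H → (es : Fin (suc L) → Subset n) → (∀ i → es i ∈ₗ E H) →
                IsSub (spanned H es) H
spanned-isSub {H = H} wf es es∈ =
  ( (let z , z∈ = edge-nonempty wf (es∈ fz) in z , x∈⋃tabulate⁺ es fz z∈)
  , Allₚ.tabulate⁺ (λ i → edge-nonempty wf (es∈ i) , x∈⋃tabulate⁺ es i)
  , p∩q⊆p _ _ )
  , (λ z∈ → let i , z∈eᵢ = x∈⋃tabulate⁻ es z∈ in edge⊆V wf (es∈ i) z∈eᵢ)
  , (λ e e∈ → let i , eq = ∈-tabulate⁻ {f = es} e∈ in subst (_∈ₗ E H) (sym eq) (es∈ i))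
  , refl

spanned-spannedBy : ∀ (H : MHG n) {L} (es : Fin L → Subset n) → SpannedBy (spanned H es) es
spanned-spannedBy H es = ∈-tabulate⁺ {f = es} , (λ e e∈ → let i , eq = ∈-tabulate⁻ {f = es} e∈ in i , sym eq) , refl

snakeOfPath : ∀ {H : MHG n} {k es a b} → WF H → PathSeq k es a b → (∀ i → es i ∈ₗ E H) →
              a ∉ M H → b ∈ M H → (∀ i {z} → z ∈ es i → z ∈ M H → z ≡ b) → InxS H a (spanned H es)
snakeOfPath {H = H} {k} {es} {a} {b} wf ps es∈ a∉M b∈M onlyMarked =
  spanned-isSub wf es es∈ , x∈⋃tabulate⁺ es fz start∈first , (λ a∈M′ → a∉M (proj₂ (x∈p∩q⁻ _ _ a∈M′)))
  , (b , b∈M′ , k , es , ps , spanned-spannedBy H es) , ≤-antisym ∣M′∣≤1 (x∈p⇒0<∣p∣ _ b∈M′)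
  where
  open Path ps
  b∈M′ : b ∈ M (spanned H es)
  b∈M′ = x∈p∩q⁺ (x∈⋃tabulate⁺ es (fromℕ k) end∈last , b∈M)
  ∣M′∣≤1 : ∣ M (spanned H es) ∣ ≤ 1
  ∣M′∣≤1 = ≤-trans (p⊆q⇒∣p∣≤∣q∣ {q = ⁅ b ⁆} λ z∈ →
             let z∈V , z∈M = x∈p∩q⁻ _ _ z∈ ; i , z∈eᵢ = x∈⋃tabulate⁻ es z∈V in
             subst (_∈ ⁅ b ⁆) (sym (onlyMarked i z∈eᵢ z∈M)) (x∈⁅x⁆ b))
           (≤-reflexive (∣⁅x⁆∣≡1 b))

closeCycle : ∀ {k es a x′} {f : Subset n} → PathSeq (suc k) es a x′ → a ∈ f - x′ → ∣ f ∣ ≡ 3 → x′ ∈ f →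
             ∣ f ∩ es fz ∣ ≡ 1 → (∀ t → 1 ≤ toℕ t → Empty (es t ∩ (f - x′))) → CycleSeq (suc k) (f ∷ᶠ es) x′
closeCycle {k = k} {es} {a} {x′} {f} ps a∈f-x′ ∣f∣≡3 x′∈f ∣f∩e₀∣≡1 later∩f =
  size , x′∈f , end∈last , (λ { (fs t) _ 2+t≤2+k → end∉earlier t (≤-pred 2+t≤2+k) }) , (λ ())
  , λ _ → linked , f∩last≡x′ , apart
  where
  open Path ps
  size : ∀ i → ∣ (f ∷ᶠ es) i ∣ ≡ 3
  size fz = ∣f∣≡3
  size (fs t) = edge-size t
  linked : ∀ i j → toℕ j ≡ suc (toℕ i) → ∣ (f ∷ᶠ es) i ∩ (f ∷ᶠ es) j ∣ ≡ 1
  linked fz (fs fz) _ = ∣f∩e₀∣≡1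
  linked fz (fs (fs j)) ()
  linked (fs i) (fs j) j≡1+i = consecutive i j (suc-injective j≡1+i)
  only-x′ : ∀ {z} t → 1 ≤ toℕ t → z ∈ f → z ∈ es t → z ≡ x′
  only-x′ {z} t 1≤t z∈f z∈eₜ with z ≟ x′
  ... | yes z≡x′ = z≡x′
  ... | no z≢x′ = ⊥-elim (later∩f t 1≤t (z , x∈p∩q⁺ (z∈eₜ , x∈p∧x≢y⇒x∈p-y z∈f z≢x′)))
  f∩last≡x′ : f ∩ es (fromℕ (suc k)) ≡ ⁅ x′ ⁆
  f∩last≡x′ = ⊆-antisym
    (λ z∈ → let z∈f , z∈last = x∈p∩q⁻ f _ z∈ in
            subst (_∈ ⁅ x′ ⁆) (sym (only-x′ (fromℕ (suc k)) (subst (1 ≤_) (sym (Finₚ.toℕ-fromℕ (suc k))) (s≤s z≤n)) z∈f z∈last)) (x∈⁅x⁆ x′))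
    (λ z∈ → subst (_∈ f ∩ es (fromℕ (suc k))) (sym (x∈⁅y⁆⇒x≡y x′ z∈)) (x∈p∩q⁺ (x′∈f , end∈last)))
  apart : ∀ i j → 2 + toℕ i ≤ toℕ j → ¬ (toℕ i ≡ 0 × toℕ j ≡ suc (suc k)) → Empty ((f ∷ᶠ es) i ∩ (f ∷ᶠ es) j)
  apart (fs i) (fs j) (s≤s 2+i≤j) _ = distant i j 2+i≤j
  apart fz (fs t) (s≤s 1≤t) ¬ends (z , z∈) with x∈p∩q⁻ f (es t) z∈
  ... | z∈f , z∈eₜ with only-x′ t 1≤t z∈f z∈eₜ
  ...   | refl = end∉earlier t (≤∧≢⇒< (Finₚ.toℕ≤pred[n] t) λ t≡1+k → ¬ends (refl , cong suc t≡1+k)) z∈eₜ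

module Hyperforest {H : MHG n} (wf : WF H) (uniform : ThreeUniform H) (acyclic : NoCycle H) where

  -- Two edges sharing two vertices form a cycle of length 2.
  linear : ∀ {e f} → e ∈ₗ E H → f ∈ₗ E H → e ≢ f → Nonempty (e ∩ f) → ∣ e ∩ f ∣ ≡ 1
  linear {e} {f} e∈ f∈ e≢f (a , a∈e∩f) with ∣ e ∩ f ∣ ≤? 1
  ... | yes ∣e∩f∣≤1 = ≤-antisym ∣e∩f∣≤1 (x∈p⇒0<∣p∣ (e ∩ f) a∈e∩f)
  ... | no ∣e∩f∣≰1 = ⊥-elim (acyclic (spanned H ef , a ,
                        spanned-isSub wf ef (λ { fz → e∈ ; (fs fz) → f∈ }) , 0 , ef , cycle , spanned-spannedBy H ef))
    where
    ef : Fin 2 → Subset n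
    ef = e ∷ᶠ (f ∷ᶠ λ ())
    cycle : CycleSeq 0 ef a
    cycle = (λ { fz → uniform e e∈ ; (fs fz) → uniform f f∈ })
          , proj₁ (x∈p∩q⁻ e f a∈e∩f) , proj₂ (x∈p∩q⁻ e f a∈e∩f)
          , (λ { fz () ; (fs fz) _ (s≤s ()) })
          , (λ _ → ≤-antisym (∣p∩q∣≤2 e f (uniform e e∈) (uniform f f∈) e≢f) (≰⇒> ∣e∩f∣≰1))
          , λ ()

  meetsOnce : ∀ {f x′ a k es} → f ∈ₗ E H → a ∈ f - x′ → PathSeq k es a x′ → (∀ t → es t ∈ₗ E H × es t ≢ f) →
              ∣ f ∩ es fz ∣ ≡ 1
  meetsOnce {a = a} f∈ a∈f-x′ ps valid =
    linear f∈ (proj₁ (valid fz)) (proj₂ (valid fz) ∘′ sym) (a , x∈p∩q⁺ (proj₁ (x∈p-y⁻ a∈f-x′) , Path.start∈first ps))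

  -- Closed up by f the path is a cycle at x′; a single edge would share two vertices with f.
  noReturnPath : ∀ {f x′ a} → f ∈ₗ E H → x′ ∈ f → a ∈ f - x′ → ∀ k (es : Fin (suc k) → Subset n) →
                 PathSeq k es a x′ → (∀ t → es t ∈ₗ E H × es t ≢ f) →
                 (∀ t → 1 ≤ toℕ t → Empty (es t ∩ (f - x′))) → ⊥
  noReturnPath {a = a} f∈ x′∈f a∈f-x′ zero es ps valid _
    with subst (2 ≤_) (meetsOnce f∈ a∈f-x′ ps valid) (2≤∣p∣ (_ ∩ es fz) (x∈p∩q⁺ (x′∈f , Path.end∈last ps))
           (x∈p∩q⁺ (proj₁ (x∈p-y⁻ a∈f-x′) , Path.start∈first ps)) (Path.ends-distinct ps))
  ... | s≤s ()
  noReturnPath {f} {x′} f∈ x′∈f a∈f-x′ (suc k) es ps valid later∩ =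
    acyclic (spanned H (f ∷ᶠ es) , x′ , spanned-isSub wf (f ∷ᶠ es) (λ { fz → f∈ ; (fs t) → proj₁ (valid t) }) ,
             suc k , f ∷ᶠ es , closeCycle ps a∈f-x′ (uniform f f∈) x′∈f (meetsOnce f∈ a∈f-x′ ps valid) later∩ ,
             spanned-spannedBy H (f ∷ᶠ es))

  noDetour : ∀ {f x′} → f ∈ₗ E H → x′ ∈ f → (w : Walk (λ e → e ∈ₗ E H × e ≢ f)) →
             Nonempty (first w ∩ (f - x′)) → x′ ∈ last w → ⊥
  noDetour {f} {x′} f∈ x′∈f w leaves returns = noReturnPath f∈ x′∈f start∈A len edges path valid later∩A
    where
    open Shortcut (λ e∈ → uniform _ (proj₁ e∈)) (λ e∈ f∈ → linear (proj₁ e∈) (proj₁ f∈)) w returns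
    open PathFrom (fromStart (f - x′) (λ x′∈ → proj₂ (x∈p-y⁻ x′∈) refl) leaves)

  SnakeEdge : Fin n → Fin n → Subset n → Set
  SnakeEdge v m e = e ∈ₗ E H × v ∉ e × (∀ {z} → z ∈ e → z ∈ M H → z ≡ m)

  snakeAvoiding : ∀ {x m v} → x ∉ M H → m ∈ M H → x ≢ m → (w : Walk (SnakeEdge v m)) →
                  x ∈ first w → m ∈ last w → ∃[ X ] (InxS H x X × v ∉ V X)
  snakeAvoiding {x} {m} {v} x∉M m∈M x≢m w x∈first m∈last =
    spanned H edges
    , snakeOfPath wf (subst (λ a → PathSeq len edges a m) start≡x path) (λ i → proj₁ (valid i)) x∉M m∈M
        (λ i → proj₂ (proj₂ (valid i)))
    , λ v∈ → let i , v∈eᵢ = x∈⋃tabulate⁻ edges v∈ in proj₁ (proj₂ (valid i)) v∈eᵢ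
    where
    open Shortcut (λ e∈ → uniform _ (proj₁ e∈)) (λ e∈ f∈ → linear (proj₁ e∈) (proj₁ f∈)) w m∈last
    open PathFrom (fromStart ⁅ x ⁆ (λ m∈ → x≢m (sym (x∈⁅y⁆⇒x≡y x m∈))) (x , x∈p∩q⁺ (x∈first , x∈⁅x⁆ x)))
    start≡x : start ≡ x
    start≡x = x∈⁅y⁆⇒x≡y x start∈A

  -- In a hyperforest every ab-path starts with the same edge; otherwise the two paths enclose a cycle.
  samePathStart : ∀ {k k′ es es′ a b} → PathSeq k es a b → (∀ t → es t ∈ₗ E H) →
                  PathSeq k′ es′ a b → (∀ t → es′ t ∈ₗ E H) → ¬ (∀ t → es′ t ≢ es fz)
  samePathStart {zero} {es = es} {es′} {b = b} ps es∈ ps′ es′∈ avoids =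
    noDetour (es∈ fz) (Path.start∈first ps) (reverseWalk forth)
      (b , x∈p∩q⁺ (pathWalk-end ps′ , x∈p∧x≢y⇒x∈p-y (Path.end∈last ps) (Path.ends-distinct ps ∘′ sym)))
      (reverseWalk-last forth (Path.start∈first ps′))
    where
    Avoiding : Subset n → Set
    Avoiding e = e ∈ₗ E H × e ≢ es fz
    valid′ : ∀ t → Avoiding (es′ t)
    valid′ t = es′∈ t , avoids t
    forth : Walk Avoiding
    forth = pathWalk ps′ valid′
  samePathStart {suc k} {es = es} {es′} ps es∈ ps′ es′∈ avoids =
    noDetour (es∈ fz) (Path.start∈first ps) walk
      (junction , x∈p∩q⁺ (proj₂ junction∈first×second ,
                          x∈p∧x≢y⇒x∈p-y (proj₁ junction∈first×second) junction≢start))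
      (joinWalks-last tailWalk backWalk meet (reverseWalk-last forth (Path.start∈first ps′)))
    where
    open Junction ps
    Avoiding : Subset n → Set
    Avoiding e = e ∈ₗ E H × e ≢ es fz
    valid′ : ∀ t → Avoiding (es′ t)
    valid′ t = es′∈ t , avoids t
    validTail : ∀ t → Avoiding (es (fs t))
    validTail t = es∈ (fs t) , λ eₜ≡e₀ →
      Path.start∉later ps (fs t) (s≤s z≤n) (subst (_ ∈_) (sym eₜ≡e₀) (Path.start∈first ps))
    tailWalk forth backWalk : Walk Avoiding
    tailWalk = pathWalk tail validTail
    forth = pathWalk ps′ valid′
    backWalk = reverseWalk forth
    meet : Nonempty (last tailWalk ∩ first backWalk)
    meet = _ , x∈p∩q⁺ (pathWalk-end tail , pathWalk-end ps′)
    walk : Walk Avoiding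
    walk = joinWalks tailWalk backWalk meet

-- Breaker's strategy

Blocks : MHG n → Fin n → Fin n → Set
Blocks H x v = v ∈ NonMarked (mark x H) × (∀ X → InxS H x X → v ∈ V X)

-- Re-establishing J₁ after a move needs case distinctions on the existence of snakes,
-- which are only available under double negation; that is enough to refute MakerWin.
WeakJ1 : MHG n → Set
WeakJ1 H = ∀ x → x ∈ NonMarked H → ¬ ¬ (∃[ v ] Blocks H x v)

move-wf : ∀ {H : MHG n} x y → WF H → x ∈ NonMarked H → Nonempty (NonMarked (move x y H)) → WF (move x y H)
move-wf {H = H} x y wf x∈ (z , z∈) =
  (z , proj₁ (x∈p─q⁻ z∈))
  , All.tabulate (λ e∈′ → let e∈ , y∉e = Move.edge⁻ H x y e∈′ in
      edge-nonempty wf e∈ , λ z∈e → x∈p∧x≢y⇒x∈p-y (edge⊆V wf e∈ z∈e) λ { refl → y∉e z∈e })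
  , λ z∈M′ → x∈p∧x≢y⇒x∈p-y ([ proj₂ (proj₂ wf) , (λ { refl → proj₁ (x∈p─q⁻ x∈) }) ]′ (Move.marked⁻ H x y z∈M′))
                            (proj₂ (x∈p-y⁻ z∈M′))

move-uniform : ∀ (H : MHG n) x y → ThreeUniform H → ThreeUniform (move x y H)
move-uniform H x y uniform e e∈ = uniform e (proj₁ (Move.edge⁻ H x y e∈))

move-acyclic : ∀ (H : MHG n) x y → NoCycle H → NoCycle (move x y H)
move-acyclic H x y acyclic (X , a , ((nonempty , edges , _) , V⊆ , E⊆ , _) , cycle) =
  acyclic (mhg (V X) (E X) (V X ∩ M H) , a ,
           ((nonempty , edges , p∩q⊆p _ _) , (λ z∈ → proj₁ (Move.vertex⁻ H x y (V⊆ z∈))) ,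
            (λ e e∈ → proj₁ (Move.edge⁻ H x y (E⊆ e e∈))) , refl) ,
           cycle)

move-snake : ∀ {H : MHG n} {x y x′ X} → InxS (move x y H) x′ X → x ∉ V X → InxS H x′ X
move-snake {H = H} {x} {y} {X = X} ((wfX , V⊆ , E⊆ , M≡) , inS) x∉X =
  (wfX , (λ z∈ → proj₁ (Move.vertex⁻ H x y (V⊆ z∈))) , (λ e e∈ → proj₁ (Move.edge⁻ H x y (E⊆ e e∈))) ,
   trans M≡ (⊆-antisym restrict extend)) , inS
  where
  restrict : V X ∩ M (move x y H) ⊆ V X ∩ M H
  restrict z∈ with x∈p∩q⁻ (V X) _ z∈
  ... | z∈X , z∈M′ = x∈p∩q⁺ (z∈X , [ (λ z∈M → z∈M) , (λ { refl → ⊥-elim (x∉X z∈X) }) ]′ (Move.marked⁻ H x y z∈M′))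
  extend : V X ∩ M H ⊆ V X ∩ M (move x y H)
  extend z∈ with x∈p∩q⁻ (V X) _ z∈
  ... | z∈X , z∈M = x∈p∩q⁺ (z∈X , Move.marked⁺ H x y z∈M (proj₂ (Move.vertex⁻ H x y (V⊆ z∈X))))

module Answer {H : MHG n} (wf : WF H) (uniform : ThreeUniform H) (acyclic : NoCycle H)
              {x v : Fin n} (x∈ : x ∈ NonMarked H) (blocks : Blocks H x v) where

  open Hyperforest wf uniform acyclic

  H′ : MHG n
  H′ = move x v H

  x∉M : x ∉ M H
  x∉M = proj₂ (x∈p─q⁻ x∈)

  x∈M′ : x ∈ M H′
  x∈M′ = Move.answered H x v (proj₁ blocks)

  marked′ : ∀ {z} → z ∈ M H → z ∈ V H′ → z ∈ M H′
  marked′ z∈M z∈V′ = Move.marked⁺ H x v z∈M (proj₂ (Move.vertex⁻ H x v z∈V′))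

  keepsTwoFree : ∀ {e} → ¬ TrivialMakerWin H → e ∈ₗ E H → v ∉ e → x ∈ e → 2 ≤ ∣ e ─ M H′ ∣
  keepsTwoFree {e} notTrivial e∈ v∉e x∈e
    with ∃-other (e ─ M H) (≰⇒> λ small → notTrivial (e , e∈ , small)) (x∈p∧x∉q⇒x∈p─q x∈e x∉M)
  ... | u , u∈e─M , u≢x with ∃-third e u (≤-reflexive (sym (uniform e e∈))) x∈e
  ...   | m , m∈e , m≢x , m≢u with m ∈? M H
  ...     | no m∉M = 2≤∣p∣ _ (Move.free⁺ H x v u∈e─M u≢x) (Move.free⁺ H x v (x∈p∧x∉q⇒x∈p─q m∈e m∉M) m≢x) m≢u
  ...     | yes m∈M = ⊥-elim (v∉e (proj₂ (x∈⋃tabulate⁻ (λ (_ : Fin 1) → e) (proj₂ blocks _ snake))))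
    where
    onlyM : ∀ {z} → z ∈ e → z ∈ M H → z ≡ m
    onlyM z∈e z∈M with ∣p∣≡3⇒members e (uniform e e∈) x∈e (proj₁ (x∈p─q⁻ u∈e─M)) m∈e u≢x m≢x m≢u z∈e
    ... | inj₁ refl = ⊥-elim (x∉M z∈M)
    ... | inj₂ (inj₁ refl) = ⊥-elim (proj₂ (x∈p─q⁻ u∈e─M) z∈M)
    ... | inj₂ (inj₂ z≡m) = z≡m
    snake : InxS H x (spanned H λ (_ : Fin 1) → e)
    snake = snakeOfPath wf (singlePath (uniform e e∈) x∈e m∈e (m≢x ∘′ sym)) (λ _ → e∈) x∉M m∈M (λ _ → onlyM)

  notTrivial′ : ¬ TrivialMakerWin H → ¬ TrivialMakerWin H′
  notTrivial′ notTrivial (e , e∈′ , ∣e─M′∣≤1) with Move.edge⁻ H x v e∈′ | x ∈? e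
  ... | e∈ , v∉e | yes x∈e = ≤⇒≯ ∣e─M′∣≤1 (keepsTwoFree notTrivial e∈ v∉e x∈e)
  ... | e∈ , _ | no x∉e = notTrivial (e , e∈ , ≤-trans (p⊆q⇒∣p∣≤∣q∣ e─M⊆e─M′) ∣e─M′∣≤1)
    where
    e─M⊆e─M′ : e ─ M H ⊆ e ─ M H′
    e─M⊆e─M′ z∈ = Move.free⁺ H x v z∈ λ { refl → x∉e (proj₁ (x∈p─q⁻ z∈)) }

  snakeEdge : ∀ {X x′} (snake : SnakeIn H′ X x′) t → SnakeEdge v (SnakeIn.end snake) (SnakeIn.edges snake t)
  snakeEdge snake t = proj₁ (Move.edge⁻ H x v (edge∈E t))
                    , (λ v∈ → proj₂ (Move.vertex⁻ H x v (X⊆V (edge⊆X t v∈))) refl)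
                    , λ z∈ z∈M → onlyMarked (edge⊆X t z∈) (marked′ z∈M (X⊆V (edge⊆X t z∈)))
    where open SnakeIn snake

  -- P leads from x to x′ and S from x′ to a marked vertex, together an x-snake of H avoiding v.
  noEscape : ∀ {x′ kP kS esP esS m} → PathSeq kP esP x′ x → (∀ t → SnakeEdge v m (esP t)) →
             PathSeq kS esS x′ m → (∀ t → SnakeEdge v m (esS t)) → m ∈ M H → x ≢ m → ⊥
  noEscape {x′ = x′} {m = m} psP validP psS validS m∈M x≢m =
    let X , snake , v∉X = snakeAvoiding x∉M m∈M x≢m walk x∈first m∈last in v∉X (proj₂ blocks X snake)
    where
    alongP back forth walk : Walk (SnakeEdge v m)
    alongP = pathWalk psP validP
    back = reverseWalk alongP
    forth = pathWalk psS validS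
    meet : Nonempty (last back ∩ first forth)
    meet = x′ , x∈p∩q⁺ (reverseWalk-last alongP (Path.start∈first psP) , Path.start∈first psS)
    walk = joinWalks back forth meet
    x∈first : x ∈ first walk
    x∈first = pathWalk-end psP
    m∈last : m ∈ last walk
    m∈last = joinWalks-last back forth meet (pathWalk-end psS)

  module _ {x′ : Fin n} (noBlocker : ¬ (∃[ w ] Blocks H′ x′ w)) where

    avoidingX : WeakJ1 H → 2 ≤ ∣ NonMarked H′ ∣ → x′ ∈ NonMarked H′ → ¬ (∃[ X ] (InxS H′ x′ X × x ∈ V X)) → ⊥
    avoidingX j1 large x′∈ none = ¬¬-excluded-middle λ
      { (no noSnake) → let w , w∈ , w≢x′ = ∃-other (NonMarked H′) large x′∈ in
          noBlocker (w , Mark.unmarked⁺ H′ x′ w∈ w≢x′ , λ X snake → ⊥-elim (noSnake (X , snake)))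
      ; (yes (S , snakeS)) → j1 x′ (proj₁ (Move.unmarked⁻ H x v x′∈)) λ (w , w∈ , w∈snakes) →
          let w∈S = w∈snakes S (lift snakeS)
              w∈V′ = proj₁ (proj₂ (proj₁ snakeS)) w∈S
              w∈NM , w≢x′ = Mark.unmarked⁻ H x′ w∈
          in noBlocker (w , Mark.unmarked⁺ H′ x′
                              (Move.unmarked⁺ H x v w∈NM (λ { refl → none (S , snakeS , w∈S) })
                                                         (proj₂ (Move.vertex⁻ H x v w∈V′))) w≢x′
                          , λ X snake → w∈snakes X (lift snake)) }
      where
      lift : ∀ {X} → InxS H′ x′ X → InxS H x′ X
      lift {X} snake = move-snake snake λ x∈X → none (X , snake , x∈X)

    -- P is a path from x′ to x without marks of H; the vertex u ∉ {x′, x} of its first edge f lies in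
    -- every x′-snake S of H′: if S ends in a mark of H it continues P to an x-snake of H missing v,
    -- and if it ends in x it is a second x′x-path avoiding f.
    throughX : ∃[ X ] (InxS H′ x′ X × x ∈ V X) → ⊥
    throughX (P , snakeP , x∈P) = noBlocker (u , u∈NM′ , λ S snakeS → decidable-stable (u ∈? V S) (missesU S snakeS))
      where
      open SnakeIn (snakeIn snakeP)
      x≡end : x ≡ end
      x≡end = onlyMarked x∈P x∈M′
      psP : PathSeq len edges x′ x
      psP = subst (PathSeq len edges x′) (sym x≡end) path
      f : Subset n
      f = edges fz
      x′∈f : x′ ∈ f
      x′∈f = Path.start∈first psP
      unmarked : ∀ i {z} → z ∈ edges i → z ∉ M H
      unmarked i z∈ z∈M = x∉M (subst (_∈ M H) (trans (proj₂ (proj₂ (snakeEdge (snakeIn snakeP) i)) z∈ z∈M) (sym x≡end)) z∈M)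
      third : ∃[ u ] (u ∈ f × u ≢ x′ × u ≢ x)
      third = ∃-third f x (≤-reflexive (sym (Path.edge-size psP fz))) x′∈f
      u : Fin n
      u = proj₁ third
      u∈f : u ∈ f
      u∈f = proj₁ (proj₂ third)
      u∈NM′ : u ∈ NonMarked (mark x′ H′)
      u∈NM′ = Mark.unmarked⁺ H′ x′ (x∈p∧x∉q⇒x∈p─q (X⊆V (edge⊆X fz u∈f))
                λ u∈M′ → [ unmarked fz u∈f , proj₂ (proj₂ (proj₂ third)) ]′ (Move.marked⁻ H x v u∈M′))
                (proj₁ (proj₂ (proj₂ third)))
      missesU : ∀ S → InxS H′ x′ S → u ∉ V S → ⊥
      missesU S snakeS u∉S with x ∈? V S
      ... | no x∉S = noEscape psP validP S.path (snakeEdge (snakeIn snakeS)) end∈MH (λ { refl → x∉S S.end∈X })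
        where
        module S = SnakeIn (snakeIn snakeS)
        end∈MH : S.end ∈ M H
        end∈MH = [ (λ end∈M → end∈M) , (λ { refl → ⊥-elim (x∉S S.end∈X) }) ]′ (Move.marked⁻ H x v S.end∈M)
        validP : ∀ t → SnakeEdge v S.end (edges t)
        validP t = let e∈ , v∉e , _ = snakeEdge (snakeIn snakeP) t in e∈ , v∉e , λ z∈ z∈M → ⊥-elim (unmarked t z∈ z∈M)
      ... | yes x∈S = samePathStart psP (λ t → proj₁ (snakeEdge (snakeIn snakeP) t))
          (subst (PathSeq S.len S.edges x′) (sym (S.onlyMarked x∈S x∈M′)) S.path) (λ t → proj₁ (snakeEdge (snakeIn snakeS) t))
          λ t eₜ≡f → u∉S (S.edge⊆X t (subst (u ∈_) (sym eₜ≡f) u∈f))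
        where
        module S = SnakeIn (snakeIn snakeS)

  weakJ1′ : WeakJ1 H → 2 ≤ ∣ NonMarked H′ ∣ → WeakJ1 H′
  weakJ1′ j1 large x′ x′∈ noBlocker = ¬¬-excluded-middle λ
    { (yes through) → throughX noBlocker through
    ; (no avoiding) → avoidingX noBlocker j1 large x′∈ avoiding }

makerWin⇒2≤∣NonMarked∣ : ∀ {H : MHG n} → ¬ TrivialMakerWin H → MakerWin H → 2 ≤ ∣ NonMarked H ∣
makerWin⇒2≤∣NonMarked∣ notTrivial (base _ trivial) = ⊥-elim (notTrivial trivial)
makerWin⇒2≤∣NonMarked∣ _ (step large _ _ _) = large

weakJ1⇒breakerWin : ∀ (H : MHG n) → WF H → ThreeUniformHyperforest H → ¬ TrivialMakerWin H → WeakJ1 H → BreakerWin H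
weakJ1⇒breakerWin = ≺-rec Invariant survives
  where
  Invariant : MHG _ → Set
  Invariant H = WF H → ThreeUniformHyperforest H → ¬ TrivialMakerWin H → WeakJ1 H → BreakerWin H
  survives : ∀ H → (∀ {H′} → H′ ≺ H → Invariant H′) → Invariant H
  survives H ih wf forest notTrivial j1 (base _ trivial) = notTrivial trivial
  survives H ih wf (uniform , acyclic) notTrivial j1 (step _ x x∈ wins) = j1 x x∈ λ (v , blocks) →
    let open Answer wf uniform acyclic x∈ blocks
        makerWins′ = wins v (proj₁ blocks)
        large′ = makerWin⇒2≤∣NonMarked∣ (notTrivial′ notTrivial) makerWins′
    in ih (Move.shrinks H x v x∈)
          (move-wf x v wf x∈ (0<∣p∣⇒Nonempty _ (<⇒≤ large′)))
          (move-uniform H x v uniform , move-acyclic H x v acyclic)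
          (notTrivial′ notTrivial) (weakJ1′ j1 large′) makerWins′

mainTheorem8 : (n : ℕ) (H : MHG n) → WF H → ThreeUniformHyperforest H →
    ¬ TrivialMakerWin H → 2 ≤ ∣ NonMarked H ∣ → (BreakerWin H ⇔ J1 H)
mainTheorem8 n H wf forest notTrivial large =
  mk⇔ (breakerWin⇒J1 H large)
      (λ j1 → weakJ1⇒breakerWin H wf forest notTrivial λ x x∈ noBlocker → noBlocker (j1 x x∈))
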